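{- Let $q$ be a prime power with $q-1=ml^2$ for integers $l,m\ge 2$. Let $\theta$ be a primitive element of $\mathbb{F}_q$, put $\beta=\theta^l$, $C=\langle\beta^m\rangle=\langle\theta^{ml}\rangle\le\mathbb{F}_q^*$, $H=\langle\beta\rangle\le\mathbb{F}_q^*$, and $A_j=\beta^jC$ for $0\le j\le m-1$. Then for any non-empty subset $S\subseteq\{1,\dots,m-1\}$, the family $\{A_0,\dots,A_{m-1}\}$ is a $(q,m,l;|S|)$-$S$-CEDF in $(\mathbb{F}_q,+)$ if and only if every coset of $H$ in $\mathbb{F}_q^*$ contains exactly $|S|$ elements of the set $$\bigcup_{c\in S}\{x-1:\ x\in A_c\}=\{\beta^{c+km}-1:\ 0\le k\le l-1,\ c\in S\}.$$
   Context: Let $(G,+)$ be a finite abelian group of order $n$ (written additively), let $l,m\ge 2$, and let $S$ be a non-empty subset of $\{1,\dots,m-1\}$. For non-empty subsets $A,B\subseteq G$, $\Delta(A,B)$ denotes the multiset $\{\{a-b: a\in A, b\in B\}\}$. A family $\{A_0,\dots,A_{m-1}\}$ of $m$ pairwise disjoint subsets of $G$ is an $(n,m,l;\lambda)$-$S$-circular external difference family (CEDF) in $G$ if $|A_i|=l$ for all $i$ and each nonzero $g\in G$ occurs exactly $\lambda$ times in the multiset union $\bigcup_{c\in S}\bigcup_{i=0}^{m-1}\Delta(A_{i+c},A_i)$, where subscripts are taken modulo $m$. -}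

module Defs where

open import Level using (0ℓ)
open import Data.Nat using (ℕ; zero; suc; _<_; _≤_)
open import Data.Nat.DivMod using (_%_; m%n<n)
open import Data.Nat.Primality using (Prime)
import Data.Nat as ℕ
open import Data.Fin using (Fin; toℕ; fromℕ<)
open import Data.List using (List; []; _∷_; length; filter; map; concatMap; upTo; allFin)
open import Data.List.Membership.Propositional using (_∈_)
open import Data.List.Relation.Unary.Unique.Propositional using (Unique)
open import Data.List.Relation.Unary.All using (All)
open import Data.List.Relation.Unary.Any using (Any; any?)
open import Data.Product using (Σ; _×_; ∃)
open import Relation.Nullary using (¬_; Dec)
open import Relation.Nullary.Decidable using (_×-dec_)
open import Relation.Binary.Definitions using (DecidableEquality)
open import Relation.Binary.PropositionalEquality using (_≡_; _≢_)
open import Algebra.Structures using (IsCommutativeRing; IsAbelianGroup)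
import Data.List.Membership.DecPropositional as DecMem

IsPrimePower : ℕ → Set
IsPrimePower q = Σ ℕ λ p → Σ ℕ λ k → Prime p × 1 ≤ k × q ≡ p ℕ.^ k

record FiniteAbGroup : Set₁ where
  infixl 6 _+_
  field
    Carrier        : Set
    _+_            : Carrier → Carrier → Carrier
    0#             : Carrier
    -_             : Carrier → Carrier
    isAbelianGroup : IsAbelianGroup _≡_ _+_ 0# -_
    _≟_            : DecidableEquality Carrier
    elements       : List Carrier
    complete       : ∀ x → x ∈ elements
    unique         : Unique elements

  order : ℕ
  order = length elements

  _-_ : Carrier → Carrier → Carrier
  x - y = x + (- y)

_⊕_ : ∀ {m} → Fin m → ℕ → Fin m
_⊕_ {suc n} i c = fromℕ< (m%n<n (toℕ i ℕ.+ c) (suc n))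

module CEDF (G : FiniteAbGroup) where
  open FiniteAbGroup G

  Δ : List Carrier → List Carrier → List Carrier
  Δ A B = concatMap (λ a → map (λ b → a - b) B) A

  mult : Carrier → List Carrier → ℕ
  mult g xs = length (filter (λ x → x ≟ g) xs)

  ValidS : ℕ → List ℕ → Set
  ValidS m S = ¬ (S ≡ []) × Unique S × All (λ c → 1 ≤ c × c < m) S

  IsCEDF : (n m l λ′ : ℕ) (S : List ℕ) (A : Fin m → List Carrier) → Set
  IsCEDF n m l λ′ S A =
    n ≡ order ×
    (∀ i → Unique (A i)) ×
    (∀ i → length (A i) ≡ l) ×
    (∀ i j x → x ∈ A i → x ∈ A j → i ≡ j) ×
    (∀ g → g ≢ 0# →
       mult g (concatMap (λ c → concatMap (λ i → Δ (A (i ⊕ c)) (A i)) (allFin m)) S)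
         ≡ λ′)

record FiniteField : Set₁ where
  infixl 7 _*_
  infixl 6 _+_
  field
    Carrier           : Set
    _+_ _*_           : Carrier → Carrier → Carrier
    -_                : Carrier → Carrier
    0# 1#             : Carrier
    isCommutativeRing : IsCommutativeRing _≡_ _+_ _*_ -_ 0# 1#
    0≢1               : 0# ≢ 1#
    inverse           : ∀ x → x ≢ 0# → Σ Carrier λ y → x * y ≡ 1#
    _≟_               : DecidableEquality Carrier
    elements          : List Carrier
    complete          : ∀ x → x ∈ elements
    unique            : Unique elements

  open IsCommutativeRing isCommutativeRing using (+-isAbelianGroup)
  open DecMem _≟_ public using (_∈?_)

  additiveGroup : FiniteAbGroup
  additiveGroup = record
    { Carrier = Carrier ; _+_ = _+_ ; 0# = 0# ; -_ = -_
    ; isAbelianGroup = +-isAbelianGroup ; _≟_ = _≟_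
    ; elements = elements ; complete = complete ; unique = unique }

  order : ℕ
  order = length elements

  _-_ : Carrier → Carrier → Carrier
  x - y = x + (- y)

  infixr 8 _^_
  _^_ : Carrier → ℕ → Carrier
  x ^ zero  = 1#
  x ^ suc k = x * (x ^ k)

  Primitive : Carrier → Set
  Primitive θ = θ ≢ 0# × (∀ x → x ≢ 0# → ∃ λ k → θ ^ k ≡ x)

  -- the coset a⟨g⟩ = { a g^k : k ∈ ℕ } of the cyclic subgroup ⟨g⟩ ≤ F*
  -- (g ≠ 0), as a duplicate-free list of field elements; since
  -- g^(q-1) = 1, exponents k < q suffice.
  InCoset : Carrier → Carrier → Carrier → Set
  InCoset a g y = Any (λ k → y ≡ a * g ^ k) (upTo order)

  inCoset? : ∀ a g y → Dec (InCoset a g y)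
  inCoset? a g y = any? (λ k → y ≟ (a * g ^ k)) (upTo order)

  coset : Carrier → Carrier → List Carrier
  coset a g = filter (inCoset? a g) elements

  countIn : Carrier → Carrier → List Carrier → ℕ
  countIn a g T = length (filter (λ y → inCoset? a g y ×-dec (y ∈? T)) elements)

module Submission where

open import Defs
open import Data.Nat as ℕ using (ℕ; zero; suc; _≤_; _<_; _∸_; z≤n; s≤s; NonZero)
import Data.Nat.Properties as ℕ
open import Data.Nat.DivMod using (_%_; _/_; m%n<n; m≡m%n+[m/n]*n)
open import Data.Fin as Fin using (Fin; toℕ; fromℕ<)
import Data.Fin.Properties as Fin
open import Data.List using (List; []; _∷_; length; filter; map; concatMap; _++_; applyUpTo; allFin)
open import Data.List.Properties using (length-applyUpTo)
open import Data.List.Membership.Propositional using (_∈_; _∉_; lose; find)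
open import Data.List.Membership.Propositional.Properties
  using (∈-applyUpTo⁺; ∈-applyUpTo⁻; ∈-filter⁺; ∈-filter⁻; ∈-upTo⁺; ∈-allFin; ∈-map⁺; ∈-map⁻; ∈-concatMap⁺; ∈-concatMap⁻)
open import Data.List.Relation.Unary.Any using (here; there; satisfied)
import Data.List.Relation.Unary.All as All
open import Data.List.Relation.Unary.AllPairs using (_∷_)
open import Data.List.Relation.Unary.Unique.Propositional using (Unique)
open import Data.List.Relation.Unary.Unique.Propositional.Properties
  using (Unique[x∷xs]⇒x∉xs; applyUpTo⁺₁; filter⁺; allFin⁺)
import Data.List.Membership.DecPropositional as DecMembership
open import Data.Product using (∃; _×_; _,_; proj₁; proj₂)
open import Data.Sum using (_⊎_; inj₁; inj₂; [_,_]′)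
open import Data.Empty using (⊥-elim)
open import Function.Bundles using (_⇔_; mk⇔)
open import Relation.Nullary using (¬_; Dec; yes; no)
open import Relation.Nullary.Decidable using (toSum; _×-dec_)
open import Relation.Unary using (Pred; Decidable)
open import Relation.Binary.Definitions using (DecidableEquality; tri<; tri≈; tri>)
open import Relation.Binary.PropositionalEquality
open import Algebra.Bundles using (CommutativeRing)
open import Algebra.Structures using (IsCommutativeRing)

-- Write q = |F|. Since θ has order q - 1 = ml², β = θ^l has order ml and γ = β^m has order l,
-- so A_j = β^j⟨γ⟩ has l elements and H = ⟨β⟩ is the disjoint union of A_0, …, A_{m-1}.
-- For g ≠ 0 the multiplicity of g in ⋃_{c∈S} ⋃_i Δ(A_{i+c}, A_i) counts the pairs (c, b)
-- with c ∈ S and b ∈ H such that b + g ∈ A_{i+c}, where A_i is the class of b. Dividing by b,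
-- this says g/b + 1 ∈ A_c, and u = g/b runs over the coset gH as b runs over H. Since the A_c
-- are disjoint, the multiplicity is |gH ∩ T|, so λ = |S| is exactly the coset condition.

module IndicatorSums where
  open import Data.Nat using (_+_; _*_)
  open import Data.Nat.Properties
  open import Algebra.Properties.CommutativeSemigroup +-commutativeSemigroup
    using () renaming (interchange to +-interchange)

  𝟙 : ∀ {p} {P : Set p} → Dec P → ℕ
  𝟙 (yes _) = 1
  𝟙 (no _)  = 0

  module _ {p} {P : Set p} where

    𝟙-yes : (d : Dec P) → P → 𝟙 d ≡ 1
    𝟙-yes (yes _) _  = refl
    𝟙-yes (no ¬p) p = ⊥-elim (¬p p)

    𝟙-no : (d : Dec P) → ¬ P → 𝟙 d ≡ 0
    𝟙-no (yes p) ¬p = ⊥-elim (¬p p)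
    𝟙-no (no _)  _  = refl

    𝟙≤1 : (d : Dec P) → 𝟙 d ≤ 1
    𝟙≤1 (yes _) = s≤s z≤n
    𝟙≤1 (no _)  = z≤n

  module _ {p q} {P : Set p} {Q : Set q} where

    𝟙-cong : (d : Dec P) (e : Dec Q) → (P → Q) → (Q → P) → 𝟙 d ≡ 𝟙 e
    𝟙-cong (yes _) (yes _) _ _ = refl
    𝟙-cong (yes p) (no ¬q) f _ = ⊥-elim (¬q (f p))
    𝟙-cong (no ¬p) (yes q) _ g = ⊥-elim (¬p (g q))
    𝟙-cong (no _)  (no _)  _ _ = refl

    𝟙-× : (d : Dec P) (e : Dec Q) → 𝟙 (d ×-dec e) ≡ 𝟙 d * 𝟙 e
    𝟙-× (yes _) (yes _) = refl
    𝟙-× (yes _) (no _)  = refl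
    𝟙-× (no _)  (yes _) = refl
    𝟙-× (no _)  (no _)  = refl

  private
    variable
      A B : Set

  ∑ : List A → (A → ℕ) → ℕ
  ∑ []       f = 0
  ∑ (x ∷ xs) f = f x + ∑ xs f

  syntax ∑ xs (λ x → e) = ∑[ x ∈ xs ] e

  ∑-cong-∈ : ∀ (xs : List A) {f g : A → ℕ} → (∀ x → x ∈ xs → f x ≡ g x) → ∑ xs f ≡ ∑ xs g
  ∑-cong-∈ []       _ = refl
  ∑-cong-∈ (x ∷ xs) h = cong₂ _+_ (h x (here refl)) (∑-cong-∈ xs (λ y y∈ → h y (there y∈)))

  ∑-cong : ∀ (xs : List A) {f g : A → ℕ} → (∀ x → f x ≡ g x) → ∑ xs f ≡ ∑ xs g
  ∑-cong xs h = ∑-cong-∈ xs (λ x _ → h x)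

  ∑-zero : ∀ (xs : List A) {f : A → ℕ} → (∀ x → x ∈ xs → f x ≡ 0) → ∑ xs f ≡ 0
  ∑-zero []       _ = refl
  ∑-zero (x ∷ xs) h = cong₂ _+_ (h x (here refl)) (∑-zero xs (λ y y∈ → h y (there y∈)))

  ∑-1 : ∀ (xs : List A) → ∑[ _ ∈ xs ] 1 ≡ length xs
  ∑-1 []       = refl
  ∑-1 (_ ∷ xs) = cong suc (∑-1 xs)

  ∑-mono-≤ : ∀ (xs : List A) {f g : A → ℕ} → (∀ x → f x ≤ g x) → ∑ xs f ≤ ∑ xs g
  ∑-mono-≤ []       _ = z≤n
  ∑-mono-≤ (x ∷ xs) h = +-mono-≤ (h x) (∑-mono-≤ xs h)

  ∑-distrib-+ : ∀ (xs : List A) (f g : A → ℕ) → ∑[ x ∈ xs ] (f x + g x) ≡ ∑ xs f + ∑ xs g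
  ∑-distrib-+ []       f g = refl
  ∑-distrib-+ (x ∷ xs) f g =
    trans (cong (f x + g x +_) (∑-distrib-+ xs f g)) (+-interchange (f x) (g x) (∑ xs f) (∑ xs g))

  ∑-distribˡ-* : ∀ (xs : List A) (k : ℕ) (f : A → ℕ) → ∑[ x ∈ xs ] (k * f x) ≡ k * ∑ xs f
  ∑-distribˡ-* []       k f = sym (*-zeroʳ k)
  ∑-distribˡ-* (x ∷ xs) k f = trans (cong (k * f x +_) (∑-distribˡ-* xs k f)) (sym (*-distribˡ-+ k (f x) _))

  ∑-comm : ∀ (xs : List A) (ys : List B) (f : A → B → ℕ) →
           ∑[ x ∈ xs ] ∑ ys (f x) ≡ ∑[ y ∈ ys ] ∑[ x ∈ xs ] f x y
  ∑-comm []       ys f = sym (∑-zero ys (λ _ _ → refl))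
  ∑-comm (x ∷ xs) ys f = trans (cong (∑ ys (f x) +_) (∑-comm xs ys f)) (sym (∑-distrib-+ ys (f x) _))

  ∑-++ : ∀ (xs ys : List A) (f : A → ℕ) → ∑ (xs ++ ys) f ≡ ∑ xs f + ∑ ys f
  ∑-++ []       ys f = refl
  ∑-++ (x ∷ xs) ys f = trans (cong (f x +_) (∑-++ xs ys f)) (sym (+-assoc (f x) _ _))

  ∑-map : ∀ (h : B → A) (xs : List B) (f : A → ℕ) → ∑ (map h xs) f ≡ ∑[ x ∈ xs ] f (h x)
  ∑-map h []       f = refl
  ∑-map h (x ∷ xs) f = cong (f (h x) +_) (∑-map h xs f)

  ∑-concatMap : ∀ (h : B → List A) (xs : List B) (f : A → ℕ) →
                ∑ (concatMap h xs) f ≡ ∑[ x ∈ xs ] ∑ (h x) f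
  ∑-concatMap h []       f = refl
  ∑-concatMap h (x ∷ xs) f = trans (∑-++ (h x) _ f) (cong (∑ (h x) f +_) (∑-concatMap h xs f))

  module _ {p} {P : Pred A p} (P? : Decidable P) where

    ∑-filter : ∀ (xs : List A) (f : A → ℕ) → ∑ (filter P? xs) f ≡ ∑[ x ∈ xs ] (𝟙 (P? x) * f x)
    ∑-filter []       f = refl
    ∑-filter (x ∷ xs) f with P? x
    ... | yes _ = cong₂ _+_ (sym (+-identityʳ (f x))) (∑-filter xs f)
    ... | no _  = ∑-filter xs f

    length-filter : ∀ (xs : List A) → length (filter P? xs) ≡ ∑[ x ∈ xs ] 𝟙 (P? x)
    length-filter xs = begin
      length (filter P? xs)           ≡⟨ ∑-1 (filter P? xs) ⟨
      ∑[ _ ∈ filter P? xs ] 1         ≡⟨ ∑-filter xs (λ _ → 1) ⟩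
      ∑[ x ∈ xs ] (𝟙 (P? x) * 1)     ≡⟨ ∑-cong xs (λ x → *-identityʳ (𝟙 (P? x))) ⟩
      ∑[ x ∈ xs ] 𝟙 (P? x)           ∎
      where open ≡-Reasoning

  module _ (_≟_ : DecidableEquality A) where
    open DecMembership _≟_ using (_∈?_)

    ∑-δ-∉ : ∀ (xs : List A) (y : A) (f : A → ℕ) → y ∉ xs → ∑[ x ∈ xs ] (𝟙 (x ≟ y) * f x) ≡ 0
    ∑-δ-∉ xs y f y∉xs = ∑-zero xs (λ x x∈xs → cong (_* f x) (𝟙-no (x ≟ y) λ { refl → y∉xs x∈xs }))

    ∑-δ : ∀ (xs : List A) (y : A) (f : A → ℕ) → Unique xs → y ∈ xs → ∑[ x ∈ xs ] (𝟙 (x ≟ y) * f x) ≡ f y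
    ∑-δ (x ∷ xs) y f u (here refl) = begin
      𝟙 (y ≟ y) * f y + ∑[ z ∈ xs ] (𝟙 (z ≟ y) * f z)
        ≡⟨ cong₂ _+_ (cong (_* f y) (𝟙-yes (y ≟ y) refl)) (∑-δ-∉ xs y f (Unique[x∷xs]⇒x∉xs u)) ⟩
      1 * f y + 0
        ≡⟨ +-identityʳ (1 * f y) ⟩
      1 * f y
        ≡⟨ *-identityˡ (f y) ⟩
      f y
        ∎
      where open ≡-Reasoning
    ∑-δ (x ∷ xs) y f u@(_ ∷ u′) (there y∈xs) =
      cong₂ _+_ (cong (_* f x) (𝟙-no (x ≟ y) λ { refl → Unique[x∷xs]⇒x∉xs u y∈xs }))
                (∑-δ xs y f u′ y∈xs)

    ∑-δ′ : ∀ (xs : List A) (y : A) (f : A → ℕ) → Unique xs → y ∈ xs → ∑[ x ∈ xs ] (𝟙 (y ≟ x) * f x) ≡ f y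
    ∑-δ′ xs y f u y∈xs =
      trans (∑-cong xs (λ x → cong (_* f x) (𝟙-cong (y ≟ x) (x ≟ y) sym sym))) (∑-δ xs y f u y∈xs)

    ∑-δ-∈? : ∀ (xs : List A) (y : A) (k : ℕ) → Unique xs →
             ∑[ x ∈ xs ] (𝟙 (x ≟ y) * k) ≡ 𝟙 (y ∈? xs) * k
    ∑-δ-∈? xs y k u with y ∈? xs
    ... | yes y∈xs = trans (∑-δ xs y (λ _ → k) u y∈xs) (sym (*-identityˡ k))
    ... | no  y∉xs = ∑-δ-∉ xs y (λ _ → k) y∉xs

  module Enumeration (_≟_ : DecidableEquality A) (elements : List A)
                     (complete : ∀ x → x ∈ elements) (unique : Unique elements) where
    open DecMembership _≟_ using (_∈?_)
    open ≡-Reasoning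

    ∑-over-elements : ∀ (xs : List A) → Unique xs → (f : A → ℕ) →
                      ∑ xs f ≡ ∑[ y ∈ elements ] (𝟙 (y ∈? xs) * f y)
    ∑-over-elements xs u f = begin
      ∑ xs f
        ≡⟨ ∑-cong xs (λ x → ∑-δ′ _≟_ elements x f unique (complete x)) ⟨
      ∑[ x ∈ xs ] ∑[ y ∈ elements ] (𝟙 (x ≟ y) * f y)
        ≡⟨ ∑-comm xs elements _ ⟩
      ∑[ y ∈ elements ] ∑[ x ∈ xs ] (𝟙 (x ≟ y) * f y)
        ≡⟨ ∑-cong elements (λ y → ∑-δ-∈? _≟_ xs y (f y) u) ⟩
      ∑[ y ∈ elements ] (𝟙 (y ∈? xs) * f y)
        ∎

    length≡∑∈? : ∀ (xs : List A) → Unique xs → length xs ≡ ∑[ y ∈ elements ] 𝟙 (y ∈? xs)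
    length≡∑∈? xs u = begin
      length xs                                ≡⟨ ∑-1 xs ⟨
      ∑[ _ ∈ xs ] 1                             ≡⟨ ∑-over-elements xs u (λ _ → 1) ⟩
      ∑[ y ∈ elements ] (𝟙 (y ∈? xs) * 1)     ≡⟨ ∑-cong elements (λ y → *-identityʳ (𝟙 (y ∈? xs))) ⟩
      ∑[ y ∈ elements ] 𝟙 (y ∈? xs)           ∎

    length-≤ : ∀ (xs : List A) → Unique xs → length xs ≤ length elements
    length-≤ xs u = subst₂ _≤_ (sym (length≡∑∈? xs u)) (∑-1 elements)
                                (∑-mono-≤ elements (λ y → 𝟙≤1 (y ∈? xs)))

    length-cong : ∀ (xs ys : List A) → Unique xs → Unique ys →
                  (∀ y → y ∈ xs → y ∈ ys) → (∀ y → y ∈ ys → y ∈ xs) → length xs ≡ length ys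
    length-cong xs ys u v xs⊆ys ys⊆xs = begin
      length xs
        ≡⟨ length≡∑∈? xs u ⟩
      ∑[ y ∈ elements ] 𝟙 (y ∈? xs)
        ≡⟨ ∑-cong elements (λ y → 𝟙-cong (y ∈? xs) (y ∈? ys) (xs⊆ys y) (ys⊆xs y)) ⟩
      ∑[ y ∈ elements ] 𝟙 (y ∈? ys)
        ≡⟨ length≡∑∈? ys v ⟨
      length ys
        ∎

    ∑-involution : ∀ (σ : A → A) → (∀ x → σ (σ x) ≡ x) → (f : A → ℕ) →
                   ∑[ x ∈ elements ] f (σ x) ≡ ∑ elements f
    ∑-involution σ σσ f = begin
      ∑[ x ∈ elements ] f (σ x)
        ≡⟨ ∑-cong elements (λ x → ∑-δ′ _≟_ elements (σ x) f unique (complete (σ x))) ⟨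
      ∑[ x ∈ elements ] ∑[ y ∈ elements ] (𝟙 (σ x ≟ y) * f y)
        ≡⟨ ∑-comm elements elements _ ⟩
      ∑[ y ∈ elements ] ∑[ x ∈ elements ] (𝟙 (σ x ≟ y) * f y)
        ≡⟨ ∑-cong elements (λ y → ∑-cong elements (λ x → cong (_* f y) (swap x y))) ⟩
      ∑[ y ∈ elements ] ∑[ x ∈ elements ] (𝟙 (x ≟ σ y) * f y)
        ≡⟨ ∑-cong elements (λ y → ∑-δ _≟_ elements (σ y) _ unique (complete (σ y))) ⟩
      ∑ elements f
        ∎
      where
      swap : ∀ x y → 𝟙 (σ x ≟ y) ≡ 𝟙 (x ≟ σ y)
      swap x y = 𝟙-cong (σ x ≟ y) (x ≟ σ y) (λ σx≡y → trans (sym (σσ x)) (cong σ σx≡y))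
                                            (λ x≡σy → trans (cong σ x≡σy) (σσ y))

open IndicatorSums

module FieldProperties (F : FiniteField) where
  open FiniteField F
  open IsCommutativeRing isCommutativeRing
    using (+-comm; *-assoc; *-comm; *-identityˡ; *-identityʳ; zeroʳ; distribʳ)
  open ≡-Reasoning

  commutativeRing : CommutativeRing _ _
  commutativeRing = record { isCommutativeRing = isCommutativeRing }

  open CommutativeRing commutativeRing using (+-group; *-commutativeSemigroup)
  open import Algebra.Properties.Group +-group using (//-rightDividesˡ; //-rightDividesʳ)
  open import Algebra.Properties.CommutativeSemigroup *-commutativeSemigroup public
    using (xy∙z≈xz∙y) renaming (interchange to *-interchange)

  x-y+y≡x : ∀ x y → (x - y) + y ≡ x
  x-y+y≡x x y = //-rightDividesˡ y x

  x+y-y≡x : ∀ x y → (x + y) - y ≡ x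
  x+y-y≡x x y = //-rightDividesʳ y x

  x-y≡z⇒x≡y+z : ∀ {x y z} → x - y ≡ z → x ≡ y + z
  x-y≡z⇒x≡y+z {x} {y} {z} e = begin
    x           ≡⟨ x-y+y≡x x y ⟨
    (x - y) + y ≡⟨ cong (_+ y) e ⟩
    z + y       ≡⟨ +-comm z y ⟩
    y + z       ∎

  x≡y+z⇒x-y≡z : ∀ {x y z} → x ≡ y + z → x - y ≡ z
  x≡y+z⇒x-y≡z {y = y} {z} refl = trans (cong (_- y) (+-comm y z)) (x+y-y≡x z y)

  1≢0 : 1# ≢ 0#
  1≢0 e = 0≢1 (sym e)

  *-cancelˡ : ∀ {z x y} → z ≢ 0# → z * x ≡ z * y → x ≡ y
  *-cancelˡ {z} {x} {y} z≢0 e = begin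
    x              ≡⟨ *-identityˡ x ⟨
    1# * x         ≡⟨ cong (_* x) z′z≡1 ⟨
    (z′ * z) * x   ≡⟨ *-assoc z′ z x ⟩
    z′ * (z * x)   ≡⟨ cong (z′ *_) e ⟩
    z′ * (z * y)   ≡⟨ *-assoc z′ z y ⟨
    (z′ * z) * y   ≡⟨ cong (_* y) z′z≡1 ⟩
    1# * y         ≡⟨ *-identityˡ y ⟩
    y              ∎
    where
    z′ : Carrier
    z′ = proj₁ (inverse z z≢0)
    z′z≡1 : z′ * z ≡ 1#
    z′z≡1 = trans (*-comm z′ z) (proj₂ (inverse z z≢0))

  x*y≢0 : ∀ {x y} → x ≢ 0# → y ≢ 0# → x * y ≢ 0#
  x*y≢0 {x} x≢0 y≢0 e = y≢0 (*-cancelˡ x≢0 (trans e (sym (zeroʳ x))))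

  -- A total inverse, with the junk value 0⁻¹ = 0.
  infix 9 _⁻¹
  _⁻¹ : Carrier → Carrier
  x ⁻¹ with x ≟ 0#
  ... | yes _   = 0#
  ... | no x≢0 = proj₁ (inverse x x≢0)

  x*x⁻¹≡1 : ∀ {x} → x ≢ 0# → x * x ⁻¹ ≡ 1#
  x*x⁻¹≡1 {x} x≢0 with x ≟ 0#
  ... | yes x≡0 = ⊥-elim (x≢0 x≡0)
  ... | no x≢0′ = proj₂ (inverse x x≢0′)

  x⁻¹*x≡1 : ∀ {x} → x ≢ 0# → x ⁻¹ * x ≡ 1#
  x⁻¹*x≡1 {x} x≢0 = trans (*-comm (x ⁻¹) x) (x*x⁻¹≡1 x≢0)

  0⁻¹≡0 : 0# ⁻¹ ≡ 0#
  0⁻¹≡0 with 0# ≟ 0#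
  ... | yes _    = refl
  ... | no 0≢0 = ⊥-elim (0≢0 refl)

  x⁻¹≢0 : ∀ {x} → x ≢ 0# → x ⁻¹ ≢ 0#
  x⁻¹≢0 {x} x≢0 e = 1≢0 (begin
    1#          ≡⟨ x*x⁻¹≡1 x≢0 ⟨
    x * x ⁻¹    ≡⟨ cong (x *_) e ⟩
    x * 0#      ≡⟨ zeroʳ x ⟩
    0#          ∎)

  ⁻¹-involutive : ∀ {x} → x ≢ 0# → x ⁻¹ ⁻¹ ≡ x
  ⁻¹-involutive {x} x≢0 =
    *-cancelˡ (x⁻¹≢0 x≢0) (trans (x*x⁻¹≡1 (x⁻¹≢0 x≢0)) (sym (x⁻¹*x≡1 x≢0)))

  ⁻¹-distrib-* : ∀ {x y} → x ≢ 0# → y ≢ 0# → (x * y) ⁻¹ ≡ x ⁻¹ * y ⁻¹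
  ⁻¹-distrib-* {x} {y} x≢0 y≢0 =
    *-cancelˡ (x*y≢0 x≢0 y≢0) (trans (x*x⁻¹≡1 (x*y≢0 x≢0 y≢0)) (sym xy[x⁻¹y⁻¹]≡1))
    where
    xy[x⁻¹y⁻¹]≡1 : (x * y) * (x ⁻¹ * y ⁻¹) ≡ 1#
    xy[x⁻¹y⁻¹]≡1 = begin
      (x * y) * (x ⁻¹ * y ⁻¹)   ≡⟨ *-interchange x y (x ⁻¹) (y ⁻¹) ⟩
      (x * x ⁻¹) * (y * y ⁻¹)   ≡⟨ cong₂ _*_ (x*x⁻¹≡1 x≢0) (x*x⁻¹≡1 y≢0) ⟩
      1# * 1#                   ≡⟨ *-identityˡ 1# ⟩
      1#                        ∎

  x*y*y⁻¹≡x : ∀ x {y} → y ≢ 0# → x * y * y ⁻¹ ≡ x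
  x*y*y⁻¹≡x x {y} y≢0 = trans (*-assoc x y _) (trans (cong (x *_) (x*x⁻¹≡1 y≢0)) (*-identityʳ x))

  x*y⁻¹*y≡x : ∀ x {y} → y ≢ 0# → x * y ⁻¹ * y ≡ x
  x*y⁻¹*y≡x x {y} y≢0 = trans (*-assoc x _ y) (trans (cong (x *_) (x⁻¹*x≡1 y≢0)) (*-identityʳ x))

  [x+y]*x⁻¹≡y*x⁻¹+1 : ∀ {x} y → x ≢ 0# → (x + y) * x ⁻¹ ≡ y * x ⁻¹ + 1#
  [x+y]*x⁻¹≡y*x⁻¹+1 {x} y x≢0 =
    trans (distribʳ (x ⁻¹) x y) (trans (cong (_+ y * x ⁻¹) (x*x⁻¹≡1 x≢0)) (+-comm 1# _))

  ^-+ : ∀ x a b → x ^ (a ℕ.+ b) ≡ x ^ a * x ^ b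
  ^-+ x zero    b = sym (*-identityˡ _)
  ^-+ x (suc a) b = trans (cong (x *_) (^-+ x a b)) (sym (*-assoc x _ _))

  ^-* : ∀ x a b → x ^ (a ℕ.* b) ≡ (x ^ a) ^ b
  ^-* x a zero    = cong (x ^_) (ℕ.*-zeroʳ a)
  ^-* x a (suc b) = begin
    x ^ (a ℕ.* suc b)      ≡⟨ cong (x ^_) (ℕ.*-suc a b) ⟩
    x ^ (a ℕ.+ a ℕ.* b)    ≡⟨ ^-+ x a (a ℕ.* b) ⟩
    x ^ a * x ^ (a ℕ.* b)  ≡⟨ cong (x ^ a *_) (^-* x a b) ⟩
    x ^ a * (x ^ a) ^ b    ∎

  1^ : ∀ k → 1# ^ k ≡ 1#
  1^ zero    = refl
  1^ (suc k) = trans (*-identityˡ _) (1^ k)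

  x^r≡1⇒x^[r*k]≡1 : ∀ {x} r → x ^ r ≡ 1# → ∀ k → x ^ (r ℕ.* k) ≡ 1#
  x^r≡1⇒x^[r*k]≡1 {x} r e k = trans (^-* x r k) (trans (cong (_^ k) e) (1^ k))

  ^≢0 : ∀ {x} k → x ≢ 0# → x ^ k ≢ 0#
  ^≢0 zero    _   = 1≢0
  ^≢0 (suc k) x≢0 = x*y≢0 x≢0 (^≢0 k x≢0)

  ^-% : ∀ {x} r .{{_ : NonZero r}} → x ^ r ≡ 1# → ∀ k → x ^ k ≡ x ^ (k % r)
  ^-% {x} r e k = begin
    x ^ k                                   ≡⟨ cong (x ^_) (m≡m%n+[m/n]*n k r) ⟩
    x ^ (k % r ℕ.+ (k / r) ℕ.* r)           ≡⟨ ^-+ x (k % r) _ ⟩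
    x ^ (k % r) * x ^ ((k / r) ℕ.* r)       ≡⟨ cong (λ t → x ^ (k % r) * x ^ t) (ℕ.*-comm (k / r) r) ⟩
    x ^ (k % r) * x ^ (r ℕ.* (k / r))       ≡⟨ cong (x ^ (k % r) *_) (x^r≡1⇒x^[r*k]≡1 r e (k / r)) ⟩
    x ^ (k % r) * 1#                        ≡⟨ *-identityʳ _ ⟩
    x ^ (k % r)                             ∎

module PrimitiveElement (F : FiniteField) (θ : FiniteField.Carrier F)
                        (prim : FiniteField.Primitive F θ) where
  open FiniteField F
  open FieldProperties F
  open Enumeration _≟_ elements complete unique
  open IsCommutativeRing isCommutativeRing using (*-identityʳ)

  θ≢0 : θ ≢ 0#
  θ≢0 = proj₁ prim

  NoPeriodBelow : ℕ → Set
  NoPeriodBelow n = ∀ e → 1 ≤ e → e < n → θ ^ e ≢ 1#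

  IsOrder : ℕ → Set
  IsOrder d = 1 ≤ d × θ ^ d ≡ 1# × NoPeriodBelow d

  order-search : ∀ n → (∃ λ d → IsOrder d) ⊎ NoPeriodBelow (suc n)
  order-search zero = inj₂ λ { e (s≤s _) (s≤s ()) }
  order-search (suc n) with order-search n
  ... | inj₁ found = inj₁ found
  ... | inj₂ none with (θ ^ suc n) ≟ 1#
  ...   | yes θ^n+1≡1 = inj₁ (suc n , s≤s z≤n , θ^n+1≡1 , none)
  ...   | no  θ^n+1≢1 = inj₂ none′
    where
    none′ : NoPeriodBelow (suc (suc n))
    none′ e 1≤e (s≤s e≤n+1) with ℕ.m≤n⇒m<n∨m≡n e≤n+1
    ... | inj₁ e<n+1 = none e 1≤e e<n+1
    ... | inj₂ refl  = θ^n+1≢1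

  powers-distinct : ∀ {n} → NoPeriodBelow n → ∀ {i j} → i < j → j < n → θ ^ i ≢ θ ^ j
  powers-distinct none {i} {j} i<j j<n θ^i≡θ^j =
    none (j ∸ i) (ℕ.m<n⇒0<n∸m i<j) (ℕ.≤-<-trans (ℕ.m∸n≤m j i) j<n) (*-cancelˡ (^≢0 i θ≢0) (begin
      θ ^ i * θ ^ (j ∸ i)    ≡⟨ ^-+ θ i (j ∸ i) ⟨
      θ ^ (i ℕ.+ (j ∸ i))    ≡⟨ cong (θ ^_) (ℕ.m+[n∸m]≡n (ℕ.<⇒≤ i<j)) ⟩
      θ ^ j                  ≡⟨ θ^i≡θ^j ⟨
      θ ^ i                  ≡⟨ *-identityʳ (θ ^ i) ⟨
      θ ^ i * 1#             ∎))
    where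
    open ≡-Reasoning

  powers : ℕ → List Carrier
  powers n = 0# ∷ applyUpTo (θ ^_) n

  powers-unique : ∀ {n} → NoPeriodBelow n → Unique (powers n)
  powers-unique {n} none = All.tabulate 0∉ ∷ applyUpTo⁺₁ (θ ^_) n (powers-distinct none)
    where
    0∉ : ∀ {y} → y ∈ applyUpTo (θ ^_) n → 0# ≢ y
    0∉ y∈ with ∈-applyUpTo⁻ (θ ^_) y∈
    ... | i , _ , refl = λ 0≡θ^i → ^≢0 i θ≢0 (sym 0≡θ^i)

  length-powers : ∀ n → length (powers n) ≡ suc n
  length-powers n = cong suc (length-applyUpTo (θ ^_) n)

  -- Otherwise 0, θ⁰, …, θ^(q-1) would be q + 1 distinct field elements.
  θ-order : ∃ λ d → IsOrder d
  θ-order with order-search order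
  ... | inj₁ found = found
  ... | inj₂ none  = ⊥-elim (ℕ.1+n≰n (subst (_≤ order) (length-powers order)
                                        (length-≤ (powers order) (powers-unique none′))))
    where
    none′ : NoPeriodBelow order
    none′ e 1≤e e<q = none e 1≤e (ℕ.m<n⇒m<1+n e<q)

  d : ℕ
  d = proj₁ θ-order

  θ^d≡1 : θ ^ d ≡ 1#
  θ^d≡1 = proj₁ (proj₂ (proj₂ θ-order))

  no-period-below-d : NoPeriodBelow d
  no-period-below-d = proj₂ (proj₂ (proj₂ θ-order))

  instance
    d-nonZero : NonZero d
    d-nonZero = ℕ.>-nonZero (proj₁ (proj₂ θ-order))

  powers-complete : ∀ y → y ∈ powers d
  powers-complete y with y ≟ 0#
  ... | yes refl = here refl
  ... | no  y≢0  with proj₂ prim y y≢0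
  ...   | k , refl = there (subst (_∈ applyUpTo (θ ^_) d) (sym (^-% d θ^d≡1 k))
                                    (∈-applyUpTo⁺ (θ ^_) (m%n<n k d)))

  1+d≡order : suc d ≡ order
  1+d≡order = begin
    suc d                 ≡⟨ length-powers d ⟨
    length (powers d)     ≡⟨ length-cong (powers d) elements (powers-unique no-period-below-d)
                               unique (λ y _ → complete y) (λ y _ → powers-complete y) ⟩
    order                 ∎
    where open ≡-Reasoning

  d≡order∸1 : d ≡ order ∸ 1
  d≡order∸1 = cong (_∸ 1) 1+d≡order

  order∸1<order : order ∸ 1 < order
  order∸1<order = subst (λ q → q ∸ 1 < q) 1+d≡order (ℕ.n<1+n d)

  θ^[order∸1]≡1 : θ ^ (order ∸ 1) ≡ 1#
  θ^[order∸1]≡1 = subst (λ t → θ ^ t ≡ 1#) d≡order∸1 θ^d≡1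

  ^-injective : ∀ {a b} → a < order ∸ 1 → b < order ∸ 1 → θ ^ a ≡ θ ^ b → a ≡ b
  ^-injective {a} {b} a<N b<N e with ℕ.<-cmp a b
  ... | tri< a<b _ _ = ⊥-elim (powers-distinct no-period-below-d a<b (subst (b <_) (sym d≡order∸1) b<N) e)
  ... | tri≈ _ a≡b _ = a≡b
  ... | tri> _ _ b<a = ⊥-elim (powers-distinct no-period-below-d b<a (subst (a <_) (sym d≡order∸1) a<N)
                                               (sym e))

module Cosets (F : FiniteField) where
  open FiniteField F
  open FieldProperties F
  open IsCommutativeRing isCommutativeRing using (*-assoc; *-comm; *-identityʳ)
  open ≡-Reasoning

  -- Membership in a⟨g⟩ with unbounded exponent; InCoset bounds it by the field order.
  infix 4 _∈_⟨_⟩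
  _∈_⟨_⟩ : Carrier → Carrier → Carrier → Set
  y ∈ a ⟨ g ⟩ = ∃ λ k → y ≡ a * g ^ k

  InCoset⇒∈⟨⟩ : ∀ {a g y} → InCoset a g y → y ∈ a ⟨ g ⟩
  InCoset⇒∈⟨⟩ = satisfied

  ∈⟨⟩⇒InCoset : ∀ {a g y} r .{{_ : NonZero r}} → g ^ r ≡ 1# → r < order → y ∈ a ⟨ g ⟩ → InCoset a g y
  ∈⟨⟩⇒InCoset {a} r g^r≡1 r<q (k , y≡agᵏ) =
    lose (∈-upTo⁺ (ℕ.<-trans (m%n<n k r) r<q)) (trans y≡agᵏ (cong (a *_) (^-% r g^r≡1 k)))

  ∈⟨⟩-*ʳ : ∀ {a g y} z → y ∈ a ⟨ g ⟩ → y * z ∈ a * z ⟨ g ⟩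
  ∈⟨⟩-*ʳ {a} {g} z (k , refl) = k , xy∙z≈xz∙y a (g ^ k) z

  ∈⟨⟩-trans : ∀ {a b g y} → b ∈ a ⟨ g ⟩ → y ∈ b ⟨ g ⟩ → y ∈ a ⟨ g ⟩
  ∈⟨⟩-trans {a} {g = g} (k , refl) (k′ , refl) = k ℕ.+ k′ , (begin
    (a * g ^ k) * g ^ k′ ≡⟨ *-assoc a _ _ ⟩
    a * (g ^ k * g ^ k′) ≡⟨ cong (a *_) (^-+ g k k′) ⟨
    a * g ^ (k ℕ.+ k′)   ∎)

  -- g^k is inverted by g^(k(r-1)) when g^r = 1.
  ∈⟨⟩-sym : ∀ {a g y} r .{{_ : NonZero r}} → g ^ r ≡ 1# → y ∈ a ⟨ g ⟩ → a ∈ y ⟨ g ⟩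
  ∈⟨⟩-sym {a} {g} (suc r) g^r≡1 (k , refl) = k ℕ.* r , sym (begin
    (a * g ^ k) * g ^ (k ℕ.* r)   ≡⟨ *-assoc a _ _ ⟩
    a * (g ^ k * g ^ (k ℕ.* r))   ≡⟨ cong (a *_) (^-+ g k (k ℕ.* r)) ⟨
    a * g ^ (k ℕ.+ k ℕ.* r)       ≡⟨ cong (λ t → a * g ^ t) (trans (sym (ℕ.*-suc k r)) (ℕ.*-comm k (suc r))) ⟩
    a * g ^ (suc r ℕ.* k)         ≡⟨ cong (a *_) (x^r≡1⇒x^[r*k]≡1 (suc r) g^r≡1 k) ⟩
    a * 1#                        ≡⟨ *-identityʳ a ⟩
    a                             ∎)

  ∈⟨⟩-≢0 : ∀ {a g y} → a ≢ 0# → g ≢ 0# → y ∈ a ⟨ g ⟩ → y ≢ 0#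
  ∈⟨⟩-≢0 a≢0 g≢0 (k , refl) = x*y≢0 a≢0 (^≢0 k g≢0)

module CyclotomicClasses (F : FiniteField) (m l : ℕ) (2≤m : 2 ≤ m) (2≤l : 2 ≤ l)
                         (q∸1≡ml² : FiniteField.order F ∸ 1 ≡ m ℕ.* (l ℕ.* l))
                         (θ : FiniteField.Carrier F) (prim : FiniteField.Primitive F θ) where
  open FiniteField F
  open FieldProperties F
  open Cosets F
  open PrimitiveElement F θ prim using (θ≢0; θ^[order∸1]≡1; order∸1<order; ^-injective)
  open Enumeration _≟_ elements complete unique using (length-cong)
  open IsCommutativeRing isCommutativeRing using (*-comm; *-identityˡ)
  open ≡-Reasoning

  instance
    m-nonZero : NonZero m
    m-nonZero = ℕ.>-nonZero (ℕ.≤-trans (s≤s z≤n) 2≤m)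
    l-nonZero : NonZero l
    l-nonZero = ℕ.>-nonZero (ℕ.≤-trans (s≤s z≤n) 2≤l)
    m*l-nonZero : NonZero (m ℕ.* l)
    m*l-nonZero = ℕ.m*n≢0 m l

  β γ : Carrier
  β = θ ^ l
  γ = β ^ m

  β≢0 : β ≢ 0#
  β≢0 = ^≢0 l θ≢0

  γ≢0 : γ ≢ 0#
  γ≢0 = ^≢0 m β≢0

  l*[m*l]≡q∸1 : l ℕ.* (m ℕ.* l) ≡ order ∸ 1
  l*[m*l]≡q∸1 = begin
    l ℕ.* (m ℕ.* l)   ≡⟨ ℕ.*-assoc l m l ⟨
    l ℕ.* m ℕ.* l     ≡⟨ cong (ℕ._* l) (ℕ.*-comm l m) ⟩
    m ℕ.* l ℕ.* l     ≡⟨ ℕ.*-assoc m l l ⟩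
    m ℕ.* (l ℕ.* l)   ≡⟨ q∸1≡ml² ⟨
    order ∸ 1         ∎

  β^[m*l]≡1 : β ^ (m ℕ.* l) ≡ 1#
  β^[m*l]≡1 = trans (sym (^-* θ l (m ℕ.* l))) (trans (cong (θ ^_) l*[m*l]≡q∸1) θ^[order∸1]≡1)

  γ^l≡1 : γ ^ l ≡ 1#
  γ^l≡1 = trans (sym (^-* β m l)) β^[m*l]≡1

  m*l<q : m ℕ.* l < order
  m*l<q = ℕ.≤-<-trans (ℕ.m≤n*m (m ℕ.* l) l) (subst (_< order) (sym l*[m*l]≡q∸1) order∸1<order)

  l<q : l < order
  l<q = ℕ.≤-<-trans (ℕ.m≤n*m l m) m*l<q

  β^-injective : ∀ {a b} → a < m ℕ.* l → b < m ℕ.* l → β ^ a ≡ β ^ b → a ≡ b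
  β^-injective {a} {b} a<ml b<ml βᵃ≡βᵇ =
    ℕ.*-cancelˡ-≡ a b l (^-injective (l*-< a<ml) (l*-< b<ml) (begin
      θ ^ (l ℕ.* a) ≡⟨ ^-* θ l a ⟩
      β ^ a         ≡⟨ βᵃ≡βᵇ ⟩
      β ^ b         ≡⟨ ^-* θ l b ⟨
      θ ^ (l ℕ.* b) ∎))
    where
    l*-< : ∀ {x} → x < m ℕ.* l → l ℕ.* x < order ∸ 1
    l*-< {x} x<ml = subst (l ℕ.* x <_) l*[m*l]≡q∸1 (ℕ.*-monoʳ-< l x<ml)

  β^[i+m*k]≡β^i*γ^k : ∀ i k → β ^ (i ℕ.+ m ℕ.* k) ≡ β ^ i * γ ^ k
  β^[i+m*k]≡β^i*γ^k i k = trans (^-+ β i (m ℕ.* k)) (cong (β ^ i *_) (^-* β m k))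

  β^-split : ∀ e → β ^ e ≡ β ^ (e % m) * γ ^ (e / m)
  β^-split e = begin
    β ^ e                          ≡⟨ cong (β ^_) (m≡m%n+[m/n]*n e m) ⟩
    β ^ (e % m ℕ.+ e / m ℕ.* m)    ≡⟨ cong (λ t → β ^ (e % m ℕ.+ t)) (ℕ.*-comm (e / m) m) ⟩
    β ^ (e % m ℕ.+ m ℕ.* (e / m))  ≡⟨ β^[i+m*k]≡β^i*γ^k (e % m) (e / m) ⟩
    β ^ (e % m) * γ ^ (e / m)      ∎

  -- A_j = β^j C is the coset β^j⟨γ⟩, and H = ⟨β⟩ = 1⟨β⟩.
  infix 4 _∈A[_] _∈H
  _∈A[_] : Carrier → ℕ → Set
  y ∈A[ j ] = y ∈ β ^ j ⟨ γ ⟩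

  _∈H : Carrier → Set
  y ∈H = y ∈ 1# ⟨ β ⟩

  ∈A-≢0 : ∀ i {y} → y ∈A[ i ] → y ≢ 0#
  ∈A-≢0 i = ∈⟨⟩-≢0 (^≢0 i β≢0) γ≢0

  ∈A⇒∈H : ∀ j {y} → y ∈A[ j ] → y ∈H
  ∈A⇒∈H j (k , refl) = j ℕ.+ m ℕ.* k , trans (sym (β^[i+m*k]≡β^i*γ^k j k)) (sym (*-identityˡ _))

  ∈H⇒∈A : ∀ {y} → y ∈H → ∃ λ i → i < m × y ∈A[ i ]
  ∈H⇒∈A (e , refl) = e % m , m%n<n e m , e / m , trans (*-identityˡ _) (β^-split e)

  ∈A-disjoint : ∀ {i j y} → i < m → j < m → y ∈A[ i ] → y ∈A[ j ] → i ≡ j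
  ∈A-disjoint {i} {j} i<m j<m y∈Aᵢ y∈Aⱼ with ∈⟨⟩-trans y∈Aᵢ (∈⟨⟩-sym l γ^l≡1 y∈Aⱼ)
  ... | k , βʲ≡βⁱγᵏ = no-offset (k % l) (β^-injective j<ml (i+m*k<ml (m%n<n k l)) (begin
    β ^ j                      ≡⟨ βʲ≡βⁱγᵏ ⟩
    β ^ i * γ ^ k              ≡⟨ cong (β ^ i *_) (^-% l γ^l≡1 k) ⟩
    β ^ i * γ ^ (k % l)        ≡⟨ β^[i+m*k]≡β^i*γ^k i (k % l) ⟨
    β ^ (i ℕ.+ m ℕ.* (k % l))  ∎))
    where
    j<ml : j < m ℕ.* l
    j<ml = ℕ.<-≤-trans j<m (ℕ.m≤m*n m l)
    i+m*k<ml : ∀ {k} → k < l → i ℕ.+ m ℕ.* k < m ℕ.* l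
    i+m*k<ml {k} k<l = ℕ.<-≤-trans (ℕ.+-monoˡ-< (m ℕ.* k) i<m)
                                  (ℕ.≤-trans (ℕ.≤-reflexive (sym (ℕ.*-suc m k))) (ℕ.*-monoʳ-≤ m k<l))
    no-offset : ∀ t → j ≡ i ℕ.+ m ℕ.* t → i ≡ j
    no-offset zero    j≡i+m0 = sym (trans j≡i+m0 (trans (cong (i ℕ.+_) (ℕ.*-zeroʳ m)) (ℕ.+-identityʳ i)))
    no-offset (suc t) j≡i+m[t+1] = ⊥-elim (ℕ.<⇒≱ j<m
      (ℕ.≤-trans (ℕ.m≤m*n m (suc t)) (ℕ.≤-trans (ℕ.m≤n+m _ i) (ℕ.≤-reflexive (sym j≡i+m[t+1])))))

  ∈A⇒InCoset : ∀ j {y} → y ∈A[ j ] → InCoset (β ^ j) γ y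
  ∈A⇒InCoset j = ∈⟨⟩⇒InCoset l γ^l≡1 l<q

  ∈⟨β⟩⇒InCoset : ∀ {a y} → y ∈ a ⟨ β ⟩ → InCoset a β y
  ∈⟨β⟩⇒InCoset = ∈⟨⟩⇒InCoset (m ℕ.* l) β^[m*l]≡1 m*l<q

  ∈⟨β⟩-sym : ∀ {a y} → y ∈ a ⟨ β ⟩ → a ∈ y ⟨ β ⟩
  ∈⟨β⟩-sym = ∈⟨⟩-sym (m ℕ.* l) β^[m*l]≡1

  A : ℕ → List Carrier
  A j = coset (β ^ j) γ

  ∈A⁻ : ∀ j {y} → y ∈ A j → y ∈A[ j ]
  ∈A⁻ j y∈Aⱼ = InCoset⇒∈⟨⟩ (proj₂ (∈-filter⁻ (inCoset? (β ^ j) γ) {xs = elements} y∈Aⱼ))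

  ∈A⁺ : ∀ j {y} → y ∈A[ j ] → y ∈ A j
  ∈A⁺ j {y} y∈Aⱼ = ∈-filter⁺ (inCoset? (β ^ j) γ) (complete y) (∈A⇒InCoset j y∈Aⱼ)

  A-disjoint : ∀ {i j y} → i < m → j < m → y ∈ A i → y ∈ A j → i ≡ j
  A-disjoint {i} {j} i<m j<m y∈Aᵢ y∈Aⱼ = ∈A-disjoint i<m j<m (∈A⁻ i y∈Aᵢ) (∈A⁻ j y∈Aⱼ)

  A-unique : ∀ j → Unique (A j)
  A-unique j = filter⁺ (inCoset? (β ^ j) γ) unique

  length-A : ∀ j → length (A j) ≡ l
  length-A j = trans (length-cong (A j) listing (A-unique j) listing-unique A⊆listing listing⊆A)
                     (length-applyUpTo _ l)
    where
    listing : List Carrier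
    listing = applyUpTo (λ k → β ^ j * γ ^ k) l

    listing-unique : Unique listing
    listing-unique = applyUpTo⁺₁ _ l λ {a} {b} a<b b<l βʲγᵃ≡βʲγᵇ →
      ℕ.<⇒≢ a<b (ℕ.*-cancelˡ-≡ a b m (β^-injective
        (ℕ.*-monoʳ-< m (ℕ.<-trans a<b b<l)) (ℕ.*-monoʳ-< m b<l)
        (trans (^-* β m a) (trans (*-cancelˡ (^≢0 j β≢0) βʲγᵃ≡βʲγᵇ) (sym (^-* β m b))))))

    A⊆listing : ∀ y → y ∈ A j → y ∈ listing
    A⊆listing y y∈Aⱼ with ∈A⁻ j y∈Aⱼ
    ... | k , refl = subst (_∈ listing) (cong (β ^ j *_) (sym (^-% l γ^l≡1 k)))
                           (∈-applyUpTo⁺ _ (m%n<n k l))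

    listing⊆A : ∀ y → y ∈ listing → y ∈ A j
    listing⊆A y y∈ with ∈-applyUpTo⁻ _ y∈
    ... | k , _ , y≡βʲγᵏ = ∈A⁺ j (k , y≡βʲγᵏ)

  β^c*b∈A[i+c] : ∀ {b} i c → b ∈A[ i ] → β ^ c * b ∈A[ (i ℕ.+ c) % m ]
  β^c*b∈A[i+c] {b} i c b∈Aᵢ = ∈⟨⟩-trans ((i ℕ.+ c) / m , β^-split (i ℕ.+ c))
    (subst₂ (λ y a → y ∈ a ⟨ γ ⟩) (*-comm b (β ^ c)) (sym (^-+ β i c)) (∈⟨⟩-*ʳ (β ^ c) b∈Aᵢ))

  ∈A-shift⁺ : ∀ {b y} i c → b ∈A[ i ] → y ∈A[ (i ℕ.+ c) % m ] → y * b ⁻¹ ∈A[ c ]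
  ∈A-shift⁺ {b} {y} i c b∈Aᵢ y∈Aᵢ₊꜀ =
    subst (λ a → y * b ⁻¹ ∈ a ⟨ γ ⟩) (x*y*y⁻¹≡x (β ^ c) (∈A-≢0 i b∈Aᵢ))
          (∈⟨⟩-*ʳ (b ⁻¹) (∈⟨⟩-trans (∈⟨⟩-sym l γ^l≡1 (β^c*b∈A[i+c] i c b∈Aᵢ)) y∈Aᵢ₊꜀))

  ∈A-shift⁻ : ∀ {b y} i c → b ∈A[ i ] → y * b ⁻¹ ∈A[ c ] → y ∈A[ (i ℕ.+ c) % m ]
  ∈A-shift⁻ {b} {y} i c b∈Aᵢ yb⁻¹∈A꜀ =
    ∈⟨⟩-trans (β^c*b∈A[i+c] i c b∈Aᵢ)
              (subst (λ z → z ∈ β ^ c * b ⟨ γ ⟩) (x*y⁻¹*y≡x y (∈A-≢0 i b∈Aᵢ)) (∈⟨⟩-*ʳ b yb⁻¹∈A꜀))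

⊕-toℕ : ∀ {n} .{{_ : NonZero n}} (i : Fin n) c → toℕ (i ⊕ c) ≡ (toℕ i ℕ.+ c) % n
⊕-toℕ {ℕ.suc n} i c = Fin.toℕ-fromℕ< (m%n<n (toℕ i ℕ.+ c) (ℕ.suc n))

module DifferenceCount (F : FiniteField) (m l : ℕ) (2≤m : 2 ≤ m) (2≤l : 2 ≤ l)
                       (q∸1≡ml² : FiniteField.order F ∸ 1 ≡ m ℕ.* (l ℕ.* l))
                       (θ : FiniteField.Carrier F) (prim : FiniteField.Primitive F θ) where
  open FiniteField F
  open FieldProperties F
  open Cosets F
  open CyclotomicClasses F m l 2≤m 2≤l q∸1≡ml² θ prim
  open Enumeration _≟_ elements complete unique using (∑-over-elements; ∑-involution)
  open IsCommutativeRing isCommutativeRing using (*-assoc; *-identityˡ; zeroʳ)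
  open CEDF additiveGroup using (Δ)
  open ≡-Reasoning

  𝟙A : ℕ → Carrier → ℕ
  𝟙A j y = 𝟙 (y ∈? A j)

  𝟙A-cong : ∀ j j′ {y y′} → (y ∈A[ j ] → y′ ∈A[ j′ ]) → (y′ ∈A[ j′ ] → y ∈A[ j ]) → 𝟙A j y ≡ 𝟙A j′ y′
  𝟙A-cong j j′ {y} {y′} to from =
    𝟙-cong (y ∈? A j) (y′ ∈? A j′) (λ y∈ → ∈A⁺ j′ (to (∈A⁻ j y∈))) (λ y′∈ → ∈A⁺ j (from (∈A⁻ j′ y′∈)))

  𝟙H : Carrier → Carrier → ℕ
  𝟙H a y = 𝟙 (inCoset? a β y)

  module _ (g : Carrier) (g≢0 : g ≢ 0#) where

    ∑Δ : ∀ j′ j → ∑[ x ∈ Δ (A j′) (A j) ] 𝟙 (x ≟ g) ≡ ∑[ b ∈ elements ] (𝟙A j b ℕ.* 𝟙A j′ (b + g))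
    ∑Δ j′ j = begin
      ∑[ x ∈ Δ (A j′) (A j) ] 𝟙 (x ≟ g)
        ≡⟨ ∑-concatMap _ (A j′) _ ⟩
      ∑[ a ∈ A j′ ] ∑[ x ∈ map (λ b → a - b) (A j) ] 𝟙 (x ≟ g)
        ≡⟨ ∑-cong (A j′) (λ a → ∑-map (λ b → a - b) (A j) _) ⟩
      ∑[ a ∈ A j′ ] ∑[ b ∈ A j ] 𝟙 ((a - b) ≟ g)
        ≡⟨ ∑-comm (A j′) (A j) _ ⟩
      ∑[ b ∈ A j ] ∑[ a ∈ A j′ ] 𝟙 ((a - b) ≟ g)
        ≡⟨ ∑-cong (A j) (λ b → ∑-cong (A j′) (a-b≟g b)) ⟩
      ∑[ b ∈ A j ] ∑[ a ∈ A j′ ] (𝟙 (a ≟ (b + g)) ℕ.* 1)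
        ≡⟨ ∑-cong (A j) (λ b → ∑-δ-∈? _≟_ (A j′) (b + g) 1 (A-unique j′)) ⟩
      ∑[ b ∈ A j ] (𝟙A j′ (b + g) ℕ.* 1)
        ≡⟨ ∑-cong (A j) (λ b → ℕ.*-identityʳ _) ⟩
      ∑[ b ∈ A j ] 𝟙A j′ (b + g)
        ≡⟨ ∑-over-elements (A j) (A-unique j) _ ⟩
      ∑[ b ∈ elements ] (𝟙A j b ℕ.* 𝟙A j′ (b + g))
        ∎
      where
      a-b≟g : ∀ b a → 𝟙 ((a - b) ≟ g) ≡ 𝟙 (a ≟ (b + g)) ℕ.* 1
      a-b≟g b a = trans (𝟙-cong ((a - b) ≟ g) (a ≟ (b + g)) x-y≡z⇒x≡y+z x≡y+z⇒x-y≡z) (sym (ℕ.*-identityʳ _))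

    σ : Carrier → Carrier
    σ b = g * b ⁻¹

    σ0≡0 : σ 0# ≡ 0#
    σ0≡0 = trans (cong (g *_) 0⁻¹≡0) (zeroʳ g)

    σ-involutive : ∀ b → σ (σ b) ≡ b
    σ-involutive b = [ at-zero , off-zero ]′ (toSum (b ≟ 0#))
      where
      at-zero : b ≡ 0# → σ (σ b) ≡ b
      at-zero b≡0 = trans (cong (λ t → σ (σ t)) b≡0) (trans (cong σ σ0≡0) (trans σ0≡0 (sym b≡0)))
      off-zero : b ≢ 0# → σ (σ b) ≡ b
      off-zero b≢0 = begin
        g * (g * b ⁻¹) ⁻¹         ≡⟨ cong (g *_) (⁻¹-distrib-* g≢0 (x⁻¹≢0 b≢0)) ⟩
        g * (g ⁻¹ * b ⁻¹ ⁻¹)      ≡⟨ cong (λ t → g * (g ⁻¹ * t)) (⁻¹-involutive b≢0) ⟩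
        g * (g ⁻¹ * b)            ≡⟨ *-assoc g (g ⁻¹) b ⟨
        g * g ⁻¹ * b              ≡⟨ cong (_* b) (x*x⁻¹≡1 g≢0) ⟩
        1# * b                    ≡⟨ *-identityˡ b ⟩
        b                         ∎

    𝟙H∘σ : ∀ u → 𝟙H 1# (σ u) ≡ 𝟙H g u
    𝟙H∘σ u = [ at-zero , off-zero ]′ (toSum (u ≟ 0#))
      where
      at-zero : u ≡ 0# → 𝟙H 1# (σ u) ≡ 𝟙H g u
      at-zero u≡0 = trans (𝟙-no (inCoset? 1# β (σ u)) σu∉H) (sym (𝟙-no (inCoset? g β u) u∉gH))
        where
        σu∉H : ¬ InCoset 1# β (σ u)
        σu∉H σu∈H = ∈⟨⟩-≢0 1≢0 β≢0 (InCoset⇒∈⟨⟩ σu∈H) (trans (cong σ u≡0) σ0≡0)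
        u∉gH : ¬ InCoset g β u
        u∉gH u∈gH = ∈⟨⟩-≢0 g≢0 β≢0 (InCoset⇒∈⟨⟩ u∈gH) u≡0
      off-zero : u ≢ 0# → 𝟙H 1# (σ u) ≡ 𝟙H g u
      off-zero u≢0 = 𝟙-cong (inCoset? 1# β (σ u)) (inCoset? g β u) to from
        where
        to : InCoset 1# β (σ u) → InCoset g β u
        to σu∈H = ∈⟨β⟩⇒InCoset (∈⟨β⟩-sym (subst₂ (λ y a → y ∈ a ⟨ β ⟩) (x*y⁻¹*y≡x g u≢0) (*-identityˡ u)
                                                   (∈⟨⟩-*ʳ u (InCoset⇒∈⟨⟩ σu∈H))))
        from : InCoset g β u → InCoset 1# β (σ u)
        from u∈gH = ∈⟨β⟩⇒InCoset (subst (λ a → σ u ∈ a ⟨ β ⟩) (x*x⁻¹≡1 u≢0)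
                                         (∈⟨⟩-*ʳ (u ⁻¹) (∈⟨β⟩-sym (InCoset⇒∈⟨⟩ u∈gH))))

    -- b ∈ H lies in exactly one class A_ι, and then b + g ∈ A_(ι+c) iff (b + g)/b = σ b + 1 ∈ A_c.
    ∑-over-classes : ∀ c b → ∑[ i ∈ allFin m ] (𝟙A (toℕ i) b ℕ.* 𝟙A (toℕ (i ⊕ c)) (b + g))
                        ≡ 𝟙H 1# b ℕ.* 𝟙A c (σ b + 1#)
    ∑-over-classes c b with inCoset? 1# β b
    ... | no b∉H = ∑-zero (allFin m) λ i _ →
      cong (ℕ._* 𝟙A (toℕ (i ⊕ c)) (b + g))
           (𝟙-no (b ∈? A (toℕ i)) λ b∈Aᵢ → b∉H (∈⟨β⟩⇒InCoset (∈A⇒∈H (toℕ i) (∈A⁻ (toℕ i) b∈Aᵢ))))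
    ... | yes b∈H with ∈H⇒∈A (InCoset⇒∈⟨⟩ b∈H)
    ...   | i₀ , i₀<m , b∈Aᵢ₀ = begin
      ∑[ i ∈ allFin m ] (𝟙A (toℕ i) b ℕ.* X i)
        ≡⟨ ∑-cong (allFin m) (λ i → cong (ℕ._* X i) (b∈Aᵢ⇔i≡ι i)) ⟩
      ∑[ i ∈ allFin m ] (𝟙 (i Fin.≟ ι) ℕ.* X i)
        ≡⟨ ∑-δ Fin._≟_ (allFin m) ι X (allFin⁺ m) (∈-allFin ι) ⟩
      X ι
        ≡⟨ 𝟙A-cong (toℕ (ι ⊕ c)) c to from ⟩
      𝟙A c (σ b + 1#)
        ≡⟨ ℕ.*-identityˡ _ ⟨
      1 ℕ.* 𝟙A c (σ b + 1#)
        ∎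
      where
      ι : Fin m
      ι = fromℕ< i₀<m
      toℕι≡i₀ : toℕ ι ≡ i₀
      toℕι≡i₀ = Fin.toℕ-fromℕ< i₀<m
      X : Fin m → ℕ
      X i = 𝟙A (toℕ (i ⊕ c)) (b + g)

      b∈Aᵢ⇔i≡ι : ∀ i → 𝟙A (toℕ i) b ≡ 𝟙 (i Fin.≟ ι)
      b∈Aᵢ⇔i≡ι i = 𝟙-cong (b ∈? A (toℕ i)) (i Fin.≟ ι)
        (λ b∈Aᵢ → Fin.toℕ-injective (trans (∈A-disjoint (Fin.toℕ<n i) i₀<m (∈A⁻ (toℕ i) b∈Aᵢ) b∈Aᵢ₀)
                                             (sym toℕι≡i₀)))
        (λ { refl → ∈A⁺ (toℕ ι) (subst (λ j → b ∈A[ j ]) (sym toℕι≡i₀) b∈Aᵢ₀) })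

      ι⊕c≡i₀+c : toℕ (ι ⊕ c) ≡ (i₀ ℕ.+ c) % m
      ι⊕c≡i₀+c = trans (⊕-toℕ ι c) (cong (λ t → (t ℕ.+ c) % m) toℕι≡i₀)

      [b+g]/b≡σb+1 : (b + g) * b ⁻¹ ≡ σ b + 1#
      [b+g]/b≡σb+1 = [x+y]*x⁻¹≡y*x⁻¹+1 g (∈⟨⟩-≢0 1≢0 β≢0 (InCoset⇒∈⟨⟩ b∈H))

      to : b + g ∈A[ toℕ (ι ⊕ c) ] → σ b + 1# ∈A[ c ]
      to h = subst (λ y → y ∈A[ c ]) [b+g]/b≡σb+1
                   (∈A-shift⁺ i₀ c b∈Aᵢ₀ (subst (λ j → b + g ∈A[ j ]) ι⊕c≡i₀+c h))

      from : σ b + 1# ∈A[ c ] → b + g ∈A[ toℕ (ι ⊕ c) ]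
      from h = subst (λ j → b + g ∈A[ j ]) (sym ι⊕c≡i₀+c)
                     (∈A-shift⁻ i₀ c b∈Aᵢ₀ (subst (λ y → y ∈A[ c ]) (sym [b+g]/b≡σb+1) h))

    ∑Δ-shift : ∀ c → ∑[ i ∈ allFin m ] ∑[ x ∈ Δ (A (toℕ (i ⊕ c))) (A (toℕ i)) ] 𝟙 (x ≟ g)
                    ≡ ∑[ u ∈ elements ] (𝟙H g u ℕ.* 𝟙A c (u + 1#))
    ∑Δ-shift c = begin
      ∑[ i ∈ allFin m ] ∑[ x ∈ Δ (A (toℕ (i ⊕ c))) (A (toℕ i)) ] 𝟙 (x ≟ g)
        ≡⟨ ∑-cong (allFin m) (λ i → ∑Δ (toℕ (i ⊕ c)) (toℕ i)) ⟩
      ∑[ i ∈ allFin m ] ∑[ b ∈ elements ] (𝟙A (toℕ i) b ℕ.* 𝟙A (toℕ (i ⊕ c)) (b + g))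
        ≡⟨ ∑-comm (allFin m) elements _ ⟩
      ∑[ b ∈ elements ] ∑[ i ∈ allFin m ] (𝟙A (toℕ i) b ℕ.* 𝟙A (toℕ (i ⊕ c)) (b + g))
        ≡⟨ ∑-cong elements (∑-over-classes c) ⟩
      ∑[ b ∈ elements ] (𝟙H 1# b ℕ.* 𝟙A c (σ b + 1#))
        ≡⟨ ∑-cong elements (λ b → cong (λ t → 𝟙H 1# t ℕ.* 𝟙A c (σ b + 1#)) (σ-involutive b)) ⟨
      ∑[ b ∈ elements ] (𝟙H 1# (σ (σ b)) ℕ.* 𝟙A c (σ b + 1#))
        ≡⟨ ∑-involution σ σ-involutive (λ u → 𝟙H 1# (σ u) ℕ.* 𝟙A c (u + 1#)) ⟩
      ∑[ u ∈ elements ] (𝟙H 1# (σ u) ℕ.* 𝟙A c (u + 1#))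
        ≡⟨ ∑-cong elements (λ u → cong (ℕ._* 𝟙A c (u + 1#)) (𝟙H∘σ u)) ⟩
      ∑[ u ∈ elements ] (𝟙H g u ℕ.* 𝟙A c (u + 1#))
        ∎

  module _ (S : List ℕ) (validS : CEDF.ValidS additiveGroup m S) where
    open CEDF additiveGroup using (mult)

    S-unique : Unique S
    S-unique = proj₁ (proj₂ validS)

    S<m : ∀ {c} → c ∈ S → c < m
    S<m c∈S = proj₂ (All.lookup (proj₂ (proj₂ validS)) c∈S)

    T : List Carrier
    T = concatMap (λ c → map (λ x → x - 1#) (A c)) S

    ∈T⁻ : ∀ {u} → u ∈ T → ∃ λ c → c ∈ S × u + 1# ∈ A c
    ∈T⁻ u∈T with find (∈-concatMap⁻ (λ c → map (λ x → x - 1#) (A c)) {xs = S} u∈T)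
    ... | c , c∈S , u∈A꜀-1 with ∈-map⁻ (λ x → x - 1#) u∈A꜀-1
    ...   | x , x∈A꜀ , refl = c , c∈S , subst (_∈ A c) (sym (x-y+y≡x x 1#)) x∈A꜀

    ∈T⁺ : ∀ {u c} → c ∈ S → u + 1# ∈ A c → u ∈ T
    ∈T⁺ {u} {c} c∈S u+1∈A꜀ = ∈-concatMap⁺ (λ c → map (λ x → x - 1#) (A c)) {xs = S}
      (lose c∈S (subst (_∈ map (λ x → x - 1#) (A c)) (x+y-y≡x u 1#) (∈-map⁺ (λ x → x - 1#) u+1∈A꜀)))

    -- At most one term is 1: the classes A_c are pairwise disjoint and S has no repetitions.
    ∑-over-S : ∀ u → ∑[ c ∈ S ] 𝟙A c (u + 1#) ≡ 𝟙 (u ∈? T)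
    ∑-over-S u with u ∈? T
    ... | no u∉T = ∑-zero S λ c c∈S → 𝟙-no (u + 1# ∈? A c) (λ u+1∈A꜀ → u∉T (∈T⁺ c∈S u+1∈A꜀))
    ... | yes u∈T with ∈T⁻ u∈T
    ...   | c₀ , c₀∈S , u+1∈A꜀₀ = trans (∑-cong-∈ S only-c₀) (∑-δ ℕ._≟_ S c₀ (λ _ → 1) S-unique c₀∈S)
      where
      only-c₀ : ∀ c → c ∈ S → 𝟙A c (u + 1#) ≡ 𝟙 (c ℕ.≟ c₀) ℕ.* 1
      only-c₀ c c∈S = trans (𝟙-cong (u + 1# ∈? A c) (c ℕ.≟ c₀)
                                    (λ u+1∈A꜀ → A-disjoint (S<m c∈S) (S<m c₀∈S) u+1∈A꜀ u+1∈A꜀₀)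
                                    (λ { refl → u+1∈A꜀₀ }))
                            (sym (ℕ.*-identityʳ _))

    mult≡countIn : ∀ g → g ≢ 0# →
      mult g (concatMap (λ c → concatMap (λ i → Δ (A (toℕ (i ⊕ c))) (A (toℕ i))) (allFin m)) S)
        ≡ countIn g β T
    mult≡countIn g g≢0 = begin
      mult g (concatMap D S)
        ≡⟨ length-filter (λ x → x ≟ g) (concatMap D S) ⟩
      ∑[ x ∈ concatMap D S ] 𝟙 (x ≟ g)
        ≡⟨ ∑-concatMap D S _ ⟩
      ∑[ c ∈ S ] ∑[ x ∈ D c ] 𝟙 (x ≟ g)
        ≡⟨ ∑-cong S (λ c → ∑-concatMap _ (allFin m) _) ⟩
      ∑[ c ∈ S ] ∑[ i ∈ allFin m ] ∑[ x ∈ Δ (A (toℕ (i ⊕ c))) (A (toℕ i)) ] 𝟙 (x ≟ g)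
        ≡⟨ ∑-cong S (∑Δ-shift g g≢0) ⟩
      ∑[ c ∈ S ] ∑[ u ∈ elements ] (𝟙H g u ℕ.* 𝟙A c (u + 1#))
        ≡⟨ ∑-comm S elements _ ⟩
      ∑[ u ∈ elements ] ∑[ c ∈ S ] (𝟙H g u ℕ.* 𝟙A c (u + 1#))
        ≡⟨ ∑-cong elements (λ u → ∑-distribˡ-* S (𝟙H g u) _) ⟩
      ∑[ u ∈ elements ] (𝟙H g u ℕ.* ∑[ c ∈ S ] 𝟙A c (u + 1#))
        ≡⟨ ∑-cong elements (λ u → cong (𝟙H g u ℕ.*_) (∑-over-S u)) ⟩
      ∑[ u ∈ elements ] (𝟙H g u ℕ.* 𝟙 (u ∈? T))
        ≡⟨ ∑-cong elements (λ u → 𝟙-× (inCoset? g β u) (u ∈? T)) ⟨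
      ∑[ u ∈ elements ] 𝟙 (inCoset? g β u ×-dec u ∈? T)
        ≡⟨ length-filter (λ u → inCoset? g β u ×-dec u ∈? T) elements ⟨
      countIn g β T
        ∎
      where
      D : ℕ → List Carrier
      D c = concatMap (λ i → Δ (A (toℕ (i ⊕ c))) (A (toℕ i))) (allFin m)

theorem3 : (F : FiniteField) → let open FiniteField F in
    (m l : ℕ) → 2 ≤ m → 2 ≤ l →
    IsPrimePower order → order ℕ.∸ 1 ≡ m ℕ.* (l ℕ.* l) →
    (θ : Carrier) → Primitive θ →
    (S : List ℕ) → CEDF.ValidS additiveGroup m S →
    let β = θ ^ l
        -- A_j = β^j C  with  C = ⟨β^m⟩
        A = λ (j : ℕ) → coset (β ^ j) (β ^ m)
        -- T = ⋃_{c∈S} {x - 1 : x ∈ A_c};  cosets of H = ⟨β⟩ are x⟨β⟩, x ≠ 0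
        T = concatMap (λ c → map (λ x → x - 1#) (A c)) S
    in CEDF.IsCEDF additiveGroup order m l (length S) S (λ (i : Fin m) → A (toℕ i))
       ⇔ (∀ x → x ≢ 0# → countIn x β T ≡ length S)
theorem3 F m l 2≤m 2≤l _ q∸1≡ml² θ prim S validS =
  mk⇔ (λ { (_ , _ , _ , _ , counts) g g≢0 → trans (sym (mult≡countIn S validS g g≢0)) (counts g g≢0) })
      (λ counts → refl , (λ i → A-unique (toℕ i)) , (λ i → length-A (toℕ i))
                , (λ i j _ y∈Aᵢ y∈Aⱼ → Fin.toℕ-injective (A-disjoint (Fin.toℕ<n i) (Fin.toℕ<n j) y∈Aᵢ y∈Aⱼ))
                , λ g g≢0 → trans (mult≡countIn S validS g g≢0) (counts g g≢0))
  where
  open CyclotomicClasses F m l 2≤m 2≤l q∸1≡ml² θ prim using (A-unique; length-A; A-disjoint)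
  open DifferenceCount F m l 2≤m 2≤l q∸1≡ml² θ prim using (mult≡countIn)
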